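{- For every integer $m\ge 2$ the digraph ${\cal D}_m$ is disconnected (i.e., its underlying undirected graph is disconnected), and each of its connected components is a strongly connected digraph.
   Context: The alpha-letters are the 2-element subsets of $\{\text{up},\text{down},\text{left},\text{right}\}$: $a=\{\text{right},\text{down}\}$, $b=\{\text{up},\text{down}\}$, $c=\{\text{right},\text{up}\}$, $d=\{\text{left},\text{down}\}$, $e=\{\text{left},\text{right}\}$, $f=\{\text{left},\text{up}\}$. ${\cal D}_{ud}$ is the digraph (loops allowed) on $\{a,\dots,f\}$ with an arc $(\alpha,\beta)$ iff ($\text{down}\in\alpha\iff\text{up}\in\beta$); ${\cal D}_{lr}$ has an arc $(\alpha,\beta)$ iff ($\text{right}\in\alpha\iff\text{left}\in\beta$). ${\cal D}_m$ is the digraph whose vertices are all words $\alpha_1\cdots\alpha_m\in\{a,\dots,f\}^m$ with $(\alpha_i,\alpha_{i+1})$ an arc of ${\cal D}_{ud}$ for all $1\le i\le m$ ($\alpha_{m+1}:=\alpha_1$), and with an arc $v\to u$ iff $(v_i,u_i)$ is an arc of ${\cal D}_{lr}$ for every $i$. -}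

module Defs where

open import Data.Bool using (Bool; true; false)
open import Data.Nat using (ℕ; zero; suc)
open import Data.Fin using (Fin; toℕ)
open import Data.Vec using (Vec; lookup)
open import Data.Product using (Σ; _×_; proj₁)
open import Data.Sum using (_⊎_)
open import Relation.Binary.PropositionalEquality using (_≡_)
open import Relation.Binary.Construct.Closure.ReflexiveTransitive using (Star)
open import Relation.Binary.Construct.Closure.Symmetric using (SymClosure)

data Dir : Set where
  up down left right : Dir

-- the six alpha-letters (2-element subsets of the directions)
-- a = {right,down}, b = {up,down}, c = {right,up},
-- d = {left,down},  e = {left,right}, f = {left,up}
data Letter : Set where
  a b c d e f : Letter

_∋_ : Letter → Dir → Bool
a ∋ right = true
a ∋ down  = true
b ∋ up    = true
b ∋ down  = true
c ∋ right = true
c ∋ up    = true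
d ∋ left  = true
d ∋ down  = true
e ∋ left  = true
e ∋ right = true
f ∋ left  = true
f ∋ up    = true
_ ∋ _     = false

infix 4 _∋_

ArcUD : Letter → Letter → Set
ArcUD α β = (α ∋ down) ≡ (β ∋ up)

ArcLR : Letter → Letter → Set
ArcLR α β = (α ∋ right) ≡ (β ∋ left)

CycSucc : (m : ℕ) → Fin m → Fin m → Set
CycSucc m i j = (suc (toℕ i) ≡ toℕ j) ⊎ ((suc (toℕ i) ≡ m) × (toℕ j ≡ 0))

Vertex : ℕ → Set
Vertex m = Σ (Vec Letter m) λ w →
  ∀ (i j : Fin m) → CycSucc m i j → ArcUD (lookup w i) (lookup w j)

Arc : (m : ℕ) → Vertex m → Vertex m → Set
Arc m v u = ∀ (i : Fin m) → ArcLR (lookup (proj₁ v) i) (lookup (proj₁ u) i)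

Reach : (m : ℕ) → Vertex m → Vertex m → Set
Reach m = Star (Arc m)

WeakConn : (m : ℕ) → Vertex m → Vertex m → Set
WeakConn m = Star (SymClosure (Arc m))

-- Mirroring every letter (swapping left and right) maps D_m to its reverse digraph, and v → mirror v
-- and mirror v → v are always arcs; so each arc v → u is undone by the path u → mirror u → mirror v → v,
-- and weak components are strongly connected.  Each letter meets {left, right} and {up, down} in sets of
-- the same parity, and around the cycle the downs of the letters are the ups of their successors; hence
-- every vertex has as many lefts as rights mod 2, and an arc v → u turns the rights of v into the lefts
-- of u.  So the parity of the number of lefts is constant on weak components, and the words  e e e⋯e
-- and  a f e⋯e  have different such parities.
module Submission where

open import Defs
open import Algebra.Bundles using (CommutativeMonoid; CommutativeRing)
open import Data.Bool using (Bool; false; _xor_)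
open import Data.Bool.Properties using (xor-∧-commutativeRing; xor-same; not-¬)
open import Data.Fin using (Fin; inject₁; fromℕ; zero; suc)
open import Data.Fin.Properties using (toℕ-inject₁; toℕ-fromℕ)
open import Data.Nat using (ℕ; zero; suc; _≥_; s≤s; z≤n)
open import Data.Product using (Σ; _×_; _,_; proj₁)
open import Data.Sum using (inj₁; inj₂)
open import Data.Vec using (Vec; _∷_; lookup; map; replicate)
open import Data.Vec.Properties using (lookup-map; lookup-replicate)
open import Function using (_∘_)
open import Relation.Binary using (Rel; _⇒_)
open import Relation.Binary.Construct.Closure.ReflexiveTransitive as Star using (Star; ε; _◅_; _◅◅_)
open import Relation.Binary.Construct.Closure.Symmetric as Sym using (SymClosure; fwd; bwd)
open import Relation.Binary.PropositionalEquality as ≡ using (_≡_; cong; sym; trans; subst₂)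
open import Relation.Nullary using (¬_)

module _ {ℓ₁ ℓ₂} (M : CommutativeMonoid ℓ₁ ℓ₂) where
  open CommutativeMonoid M renaming (refl to ≈-refl)
  open import Algebra.Properties.CommutativeMonoid.Sum M using (sum; sum-init-last; sum-cong-≋)
  open import Relation.Binary.Reasoning.Setoid setoid

  sum-rotate : ∀ {m} (s t : Fin m → Carrier) →
               (∀ i j → CycSucc m i j → s i ≈ t j) → sum s ≈ sum t
  sum-rotate {zero}  s t s≈t = ≈-refl
  sum-rotate {suc k} s t s≈t = begin
    sum s                             ≈⟨ sum-init-last s ⟩
    sum (s ∘ inject₁) ∙ s (fromℕ k)   ≈⟨ ∙-cong (sum-cong-≋ init≈tail) last≈head ⟩
    sum (t ∘ suc) ∙ t zero            ≈⟨ comm _ _ ⟩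
    sum t                             ∎
    where
    init≈tail : ∀ i → s (inject₁ i) ≈ t (suc i)
    init≈tail i = s≈t _ _ (inj₁ (cong suc (toℕ-inject₁ i)))
    last≈head : s (fromℕ k) ≈ t zero
    last≈head = s≈t _ _ (inj₂ (cong suc (toℕ-fromℕ k) , ≡.refl))

module _ {ℓ₁ ℓ₂} {A : Set ℓ₁} {R : Rel A ℓ₂} (σ : A → A)
         (to-σ : ∀ x → R x (σ x)) (from-σ : ∀ x → R (σ x) x)
         (σ-reverses : ∀ x y → R x y → R (σ y) (σ x)) where

  reverse-reachable : ∀ {x y} → R x y → Star R y x
  reverse-reachable {x} {y} r = to-σ y ◅ σ-reverses x y r ◅ from-σ x ◅ ε

  connected⇒reachable : Star (SymClosure R) ⇒ Star R
  connected⇒reachable = Star.fold (Star R) step ε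
    where
    step : ∀ {x y z} → SymClosure R x y → Star R y z → Star R x z
    step (fwd r) p = r ◅ p
    step (bwd r) p = reverse-reachable r ◅◅ p

reflect : Dir → Dir
reflect up    = up
reflect down  = down
reflect left  = right
reflect right = left

mirror : Letter → Letter
mirror a = d
mirror b = b
mirror c = f
mirror d = a
mirror e = e
mirror f = c

mirror-∋ : ∀ x δ → (mirror x ∋ δ) ≡ (x ∋ reflect δ)
mirror-∋ a = λ { up → ≡.refl ; down → ≡.refl ; left → ≡.refl ; right → ≡.refl }
mirror-∋ b = λ { up → ≡.refl ; down → ≡.refl ; left → ≡.refl ; right → ≡.refl }
mirror-∋ c = λ { up → ≡.refl ; down → ≡.refl ; left → ≡.refl ; right → ≡.refl }
mirror-∋ d = λ { up → ≡.refl ; down → ≡.refl ; left → ≡.refl ; right → ≡.refl }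
mirror-∋ e = λ { up → ≡.refl ; down → ≡.refl ; left → ≡.refl ; right → ≡.refl }
mirror-∋ f = λ { up → ≡.refl ; down → ≡.refl ; left → ≡.refl ; right → ≡.refl }

lookup-mirror-∋ : ∀ {m} (w : Vec Letter m) i δ →
                  (lookup (map mirror w) i ∋ δ) ≡ (lookup w i ∋ reflect δ)
lookup-mirror-∋ w i δ = trans (cong (_∋ δ) (lookup-map i mirror w)) (mirror-∋ (lookup w i) δ)

mirrorVertex : ∀ {m} → Vertex m → Vertex m
mirrorVertex (w , arcs) = map mirror w , λ i j s →
  trans (lookup-mirror-∋ w i down) (trans (arcs i j s) (sym (lookup-mirror-∋ w j up)))

module _ {m : ℕ} where

  Arc-mirrorVertex : ∀ v → Arc m v (mirrorVertex v)
  Arc-mirrorVertex (w , _) i = sym (lookup-mirror-∋ w i left)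

  mirrorVertex-Arc : ∀ v → Arc m (mirrorVertex v) v
  mirrorVertex-Arc (w , _) i = lookup-mirror-∋ w i right

  mirrorVertex-reverses : ∀ v u → Arc m v u → Arc m (mirrorVertex u) (mirrorVertex v)
  mirrorVertex-reverses (v , _) (u , _) v→u i =
    trans (lookup-mirror-∋ u i right) (trans (sym (v→u i)) (sym (lookup-mirror-∋ v i left)))

⊕-commutativeMonoid : CommutativeMonoid _ _
⊕-commutativeMonoid = CommutativeRing.+-commutativeMonoid xor-∧-commutativeRing

open import Algebra.Properties.CommutativeMonoid.Sum ⊕-commutativeMonoid
  using (sum; sum-cong-≗; ∑-distrib-+)
open import Algebra.Properties.Group (CommutativeRing.+-group xor-∧-commutativeRing)
  using (x∙y⁻¹≈ε⇒x≈y)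

parity : ∀ {m} → Dir → Vec Letter m → Bool
parity δ w = sum (λ i → lookup w i ∋ δ)

∋-left-xor-right : ∀ x → (x ∋ left) xor (x ∋ right) ≡ (x ∋ up) xor (x ∋ down)
∋-left-xor-right a = ≡.refl
∋-left-xor-right b = ≡.refl
∋-left-xor-right c = ≡.refl
∋-left-xor-right d = ≡.refl
∋-left-xor-right e = ≡.refl
∋-left-xor-right f = ≡.refl

parity-left-xor-right : ∀ {m} (w : Vec Letter m) →
  parity left w xor parity right w ≡ parity up w xor parity down w
parity-left-xor-right w = begin
  parity left w xor parity right w  ≡⟨ ∑-distrib-+ (has left) (has right) ⟨
  sum (λ i → (lookup w i ∋ left) xor (lookup w i ∋ right))
    ≡⟨ sum-cong-≗ (∋-left-xor-right ∘ lookup w) ⟩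
  sum (λ i → (lookup w i ∋ up) xor (lookup w i ∋ down))
    ≡⟨ ∑-distrib-+ (has up) (has down) ⟩
  parity up w xor parity down w     ∎
  where
  open ≡.≡-Reasoning
  has : Dir → Fin _ → Bool
  has δ i = lookup w i ∋ δ

parity-down≡up : ∀ {m} (v : Vertex m) → parity down (proj₁ v) ≡ parity up (proj₁ v)
parity-down≡up (w , arcs) = sum-rotate ⊕-commutativeMonoid _ _ arcs

-- x∙y⁻¹≈ε⇒x≈y applies because in the xor group every element is its own inverse.
parity-left≡right : ∀ {m} (v : Vertex m) → parity left (proj₁ v) ≡ parity right (proj₁ v)
parity-left≡right v@(w , _) = x∙y⁻¹≈ε⇒x≈y _ _ (begin
  parity left w xor parity right w  ≡⟨ parity-left-xor-right w ⟩
  parity up w xor parity down w     ≡⟨ cong (parity up w xor_) (parity-down≡up v) ⟩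
  parity up w xor parity up w       ≡⟨ xor-same (parity up w) ⟩
  false                             ∎)
  where open ≡.≡-Reasoning

leftParity : ∀ {m} → Vertex m → Bool
leftParity = parity left ∘ proj₁

Arc⇒leftParity≡ : ∀ {m} (v u : Vertex m) → Arc m v u → leftParity v ≡ leftParity u
Arc⇒leftParity≡ v u v→u = trans (parity-left≡right v) (sum-cong-≗ v→u)

WeakConn⇒leftParity≡ : ∀ {m} {v u : Vertex m} → WeakConn m v u → leftParity v ≡ leftParity u
WeakConn⇒leftParity≡ = Star.fold (λ v u → leftParity v ≡ leftParity u) trans ≡.refl
                     ∘ Star.map (Sym.fold sym (λ {v} {u} → Arc⇒leftParity≡ v u))

constantVertex : ∀ {m} (x : Letter) → ArcUD x x → Vertex m
constantVertex {m} x x→x = replicate m x , λ i j _ →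
  subst₂ ArcUD (sym (lookup-replicate i x)) (sym (lookup-replicate j x)) x→x

afVertex : ∀ n → Vertex (suc (suc n))
afVertex n = a ∷ f ∷ replicate n e , arcs
  where
  no-down : ∀ i → (lookup (f ∷ replicate n e) i ∋ down) ≡ false
  no-down zero    = ≡.refl
  no-down (suc i) = cong (_∋ down) (lookup-replicate i e)

  arcs : ∀ i j → CycSucc (suc (suc n)) i j →
         ArcUD (lookup (a ∷ f ∷ replicate n e) i) (lookup (a ∷ f ∷ replicate n e) j)
  arcs zero    (suc zero)    _               = ≡.refl
  arcs zero    zero          (inj₁ ())
  arcs zero    (suc (suc _)) (inj₁ ())
  arcs zero    _             (inj₂ (() , _))
  arcs (suc i) zero          _               = no-down i
  arcs (suc i) (suc zero)    (inj₁ ())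
  arcs (suc i) (suc zero)    (inj₂ (_ , ()))
  arcs (suc i) (suc (suc j)) _               =
    trans (no-down i) (sym (cong (_∋ up) (lookup-replicate j e)))

lemma5 : (m : ℕ) → m ≥ 2 →
    (Σ (Vertex m) λ u → Σ (Vertex m) λ v → ¬ WeakConn m u v)
    × (∀ (u v : Vertex m) → WeakConn m u v → Reach m u v)
lemma5 (suc (suc n)) (s≤s (s≤s z≤n)) =
  (afVertex n , constantVertex e ≡.refl , not-¬ ≡.refl ∘ WeakConn⇒leftParity≡) ,
  λ _ _ → connected⇒reachable mirrorVertex Arc-mirrorVertex mirrorVertex-Arc mirrorVertex-reverses
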